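{- Let $m\ge2$ and $t\ge1$ be integers, and let $f_2$ be the reduced two-digit Kaprekar map on $X_m=\{0,1,\dots,m\}$. There exists $a\in X_m$ with $a\neq0$ and $f_2^t(a)=a$ if and only if $\gcd(m+1,2^t+1)>1$ or $\gcd(m+1,2^t-1)>1$. Moreover, every nonzero $a\in X_m$ with $f_2^t(a)=a$ can be written as $a=\frac{\xi(m+1)}{2^t+1}$ or $a=\frac{\xi(m+1)}{2^t-1}$ for some odd positive integer $\xi<2^t$.
   Context: Let $X=\{0,1,\dots,m^2-1\}$, each element written with two base-$m$ digits $x=d_1m+d_0$ (leading zeros allowed). Let $f(x)=\big(m\max(d_0,d_1)+\min(d_0,d_1)\big)-\big(m\min(d_0,d_1)+\max(d_0,d_1)\big)=(m-1)|d_1-d_0|$. The reduced map $f_2:X_m\to X_m$ is $f_2(a)=f(a(m-1))/(m-1)$. Concretely, $f_2(0)=0$ and $f_2(a)=|2a-m-1|$ for $1\le a\le m$. $f_2^t$ denotes the $t$-fold iterate. -}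

module Defs where

open import Data.Nat using (ℕ; zero; suc; _+_; _*_; _∸_; ∣_-_∣)
open import Function using (_∘_; id)

f₂ : ℕ → ℕ → ℕ
f₂ m zero    = zero
f₂ m (suc a) = ∣ 2 * suc a - suc m ∣

iter : ℕ → (ℕ → ℕ) → ℕ → ℕ
iter zero    g = id
iter (suc t) g = g ∘ iter t g

open import Data.Product using (∃-syntax)
open import Relation.Binary.PropositionalEquality using (_≡_)

Odd : ℕ → Set
Odd ξ = ∃[ k ] ξ ≡ 2 * k + 1

{-# OPTIONS --safe #-}
-- Write N = m + 1. For 0 < b < N we have f₂(b) = |2b − N| ≡ ±2b (mod N), the multiple of N
-- involved being odd, so along a nonzero orbit f₂ᵗ(a) ≡ ±2ᵗa (mod N) with an odd multiple of N.
-- A t-periodic a > 0 therefore satisfies a(2ᵗ ∓ 1) = ξN with ξ odd; since a < N this gives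
-- ξ < 2ᵗ, and N ∣ a(2ᵗ ∓ 1) with a < N gives gcd(N, 2ᵗ ∓ 1) > 1.
-- Conversely let D = 2ᵗ ± 1. On X_{D−1} the map f₂ keeps odd points odd, and as 2ᵗ ≡ ∓1 (mod D)
-- every odd ξ < D satisfies f₂ᵗ(ξ) ≡ ±ξ (mod D); two odd numbers below D cannot sum to D, so
-- f₂ᵗ(ξ) = ξ. If g = gcd(N, D) > 1, the odd point D/g of X_{D−1} rescales to the nonzero point
-- N/g of X_m, and f₂ commutes with this rescaling because a·D = c·N implies f₂(a)·D = f₂(c)·N.
module Submission where

open import Defs
open import Data.Nat
  using (ℕ; zero; suc; _+_; _*_; _∸_; _^_; _≤_; _<_; ∣_-_∣; s≤s; NonZero; ≢-nonZero; >-nonZero; >-nonZero⁻¹)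
open import Data.Nat.Properties
open import Data.Nat.DivMod using (_%_; [m+kn]%n≡m%n; m<n⇒m%n≡m)
open import Data.Nat.Divisibility using (_∣_; divides; ∣⇒≤; m%n≡0⇒n∣m)
open import Data.Nat.Coprimality using (gcd≡1⇒coprime; coprime-divisor)
open import Data.Nat.GCD using (gcd; gcd[m,n]≢0; gcd[m,n]∣m; gcd[m,n]∣n)
open import Data.Nat.Tactic.RingSolver using (solve)
open import Data.List using (_∷_; [])
open import Data.Product using (_×_; _,_; ∃-syntax)
open import Data.Sum using (_⊎_; inj₁; inj₂)
open import Data.Empty using (⊥-elim)
open import Function.Bundles using (_⇔_; mk⇔)
open import Relation.Nullary using (¬_)
open import Relation.Binary.PropositionalEquality
open ≡-Reasoning

Even : ℕ → Set
Even n = ∃[ k ] n ≡ 2 * k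

parity : ∀ n → Even n ⊎ Odd n
parity zero = inj₁ (0 , refl)
parity (suc n) with parity n
... | inj₁ (k , n≡2k)   = inj₂ (k , trans (cong suc n≡2k) (+-comm 1 (2 * k)))
... | inj₂ (k , n≡2k+1) = inj₁ (suc k , trans (cong suc n≡2k+1) (solve (k ∷ [])))

odd≢even : ∀ x y → 2 * x + 1 ≢ 2 * y
odd≢even x y eq = even≢odd y x (trans (sym eq) (+-comm (2 * x) 1))

odd⇒¬even : ∀ {n} → Odd n → ¬ Even n
odd⇒¬even (x , n≡2x+1) (y , n≡2y) = odd≢even x y (trans (sym n≡2x+1) n≡2y)

odd⇒≢0 : ∀ {n} → Odd n → n ≢ 0
odd⇒≢0 odd-n n≡0 = odd⇒¬even odd-n (0 , n≡0)

odd-*ˡ : ∀ m n → Odd (m * n) → Odd m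
odd-*ˡ m n odd-mn with parity m
... | inj₂ odd-m       = odd-m
... | inj₁ (k , m≡2k) =
  ⊥-elim (odd⇒¬even odd-mn (k * n , trans (cong (_* n) m≡2k) (*-assoc 2 k n)))

even+even : ∀ {x y} → Even x → Even y → Even (x + y)
even+even (i , refl) (j , refl) = i + j , sym (*-distribˡ-+ 2 i j)

even+odd : ∀ {x y} → Even x → Odd y → Odd (x + y)
even+odd (i , refl) (j , refl) = i + j , solve (i ∷ j ∷ [])

odd+odd : ∀ {x y} → Odd x → Odd y → Even (x + y)
odd+odd (i , refl) (j , refl) = i + j + 1 , solve (i ∷ j ∷ [])

AbsDiff : ℕ → ℕ → ℕ → Set
AbsDiff c x y = c + y ≡ x ⊎ c + x ≡ y

f₂-absDiff : ∀ m b → b ≢ 0 → AbsDiff (f₂ m b) (2 * b) (suc m)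
f₂-absDiff m zero    b≢0 = ⊥-elim (b≢0 refl)
f₂-absDiff m (suc b) _ with ≤-total (suc m) (2 * suc b)
... | inj₁ N≤2b = inj₁ (trans (cong (_+ suc m)     (m≤n⇒∣n-m∣≡n∸m N≤2b)) (m∸n+n≡m N≤2b))
... | inj₂ 2b≤N = inj₂ (trans (cong (_+ 2 * suc b) (m≤n⇒∣m-n∣≡n∸m 2b≤N)) (m∸n+n≡m 2b≤N))

Orbit : ℕ → ℕ → ℕ → ℕ → Set
Orbit N P a b = ∃[ j ] (b + (2 * j + 1) * N ≡ P * a ⊎ b + P * a ≡ (2 * j + 1) * N)

orbit-start : ∀ {N a c} → AbsDiff c (2 * a) N → Orbit N 2 a c
orbit-start {N} {a} {c} (inj₁ c+N≡2a) = 0 , inj₁ (begin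
  c + 1 * N ≡⟨ cong (c +_) (*-identityˡ N) ⟩
  c + N     ≡⟨ c+N≡2a ⟩
  2 * a     ∎)
orbit-start {N} {a} {c} (inj₂ c+2a≡N) = 0 , inj₂ (trans c+2a≡N (sym (*-identityˡ N)))

orbit-step : ∀ {N P a b c} → AbsDiff c (2 * b) N → Orbit N P a b → Orbit N (2 * P) a c
orbit-step {N} {P} {a} {b} {c} (inj₁ c+N≡2b) (j , inj₁ b+kN≡Pa) = 2 * j + 1 , inj₁ (begin
  c + (2 * (2 * j + 1) + 1) * N   ≡⟨ solve (c ∷ j ∷ N ∷ []) ⟩
  (c + N) + 2 * ((2 * j + 1) * N) ≡⟨ cong (_+ 2 * ((2 * j + 1) * N)) c+N≡2b ⟩
  2 * b + 2 * ((2 * j + 1) * N)   ≡⟨ solve (b ∷ j ∷ N ∷ []) ⟩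
  2 * (b + (2 * j + 1) * N)       ≡⟨ cong (2 *_) b+kN≡Pa ⟩
  2 * (P * a)                     ≡⟨ *-assoc 2 P a ⟨
  2 * P * a                       ∎)
orbit-step {N} {P} {a} {b} {c} (inj₂ c+2b≡N) (j , inj₁ b+kN≡Pa) = 2 * j + 1 , inj₂ (begin
  c + 2 * P * a                       ≡⟨ cong (c +_) (*-assoc 2 P a) ⟩
  c + 2 * (P * a)                     ≡⟨ cong (λ x → c + 2 * x) b+kN≡Pa ⟨
  c + 2 * (b + (2 * j + 1) * N)       ≡⟨ solve (c ∷ b ∷ j ∷ N ∷ []) ⟩
  (c + 2 * b) + 2 * ((2 * j + 1) * N) ≡⟨ cong (_+ 2 * ((2 * j + 1) * N)) c+2b≡N ⟩
  N + 2 * ((2 * j + 1) * N)           ≡⟨ solve (j ∷ N ∷ []) ⟩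
  (2 * (2 * j + 1) + 1) * N           ∎)
orbit-step {N} {P} {a} {b} {c} (inj₁ c+N≡2b) (j , inj₂ b+Pa≡kN) =
  2 * j , inj₂ (+-cancelʳ-≡ N _ _ (begin
  c + 2 * P * a + N         ≡⟨ solve (c ∷ P ∷ a ∷ N ∷ []) ⟩
  (c + N) + 2 * P * a       ≡⟨ cong (_+ 2 * P * a) c+N≡2b ⟩
  2 * b + 2 * P * a         ≡⟨ solve (b ∷ P ∷ a ∷ []) ⟩
  2 * (b + P * a)           ≡⟨ cong (2 *_) b+Pa≡kN ⟩
  2 * ((2 * j + 1) * N)     ≡⟨ solve (j ∷ N ∷ []) ⟩
  (2 * (2 * j) + 1) * N + N ∎))
orbit-step {N} {P} {a} {b} {c} (inj₂ c+2b≡N) (j , inj₂ b+Pa≡kN) =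
  2 * j , inj₁ (+-cancelʳ-≡ N _ _ (begin
  c + (2 * (2 * j) + 1) * N + N ≡⟨ solve (c ∷ j ∷ N ∷ []) ⟩
  c + 2 * ((2 * j + 1) * N)     ≡⟨ cong (λ x → c + 2 * x) b+Pa≡kN ⟨
  c + 2 * (b + P * a)           ≡⟨ solve (c ∷ b ∷ P ∷ a ∷ []) ⟩
  (c + 2 * b) + 2 * P * a       ≡⟨ cong (_+ 2 * P * a) c+2b≡N ⟩
  N + 2 * P * a                 ≡⟨ +-comm N _ ⟩
  2 * P * a + N                 ∎))

iter-f₂-orbit : ∀ m t a → a ≢ 0 → iter (suc t) (f₂ m) a ≢ 0 →
  Orbit (suc m) (2 ^ suc t) a (iter (suc t) (f₂ m) a)
iter-f₂-orbit m zero    a a≢0 _   = orbit-start {a = a} (f₂-absDiff m a a≢0)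
iter-f₂-orbit m (suc t) a a≢0 b′≢0 =
  orbit-step {P = 2 ^ suc t} {a = a} (f₂-absDiff m b b≢0) (iter-f₂-orbit m t a a≢0 b≢0)
  where
    b = iter (suc t) (f₂ m) a
    b≢0 : b ≢ 0
    b≢0 b≡0 = b′≢0 (cong (f₂ m) b≡0)

orbit-fixed-point : ∀ {N Q a} → Orbit N Q a a →
  ∃[ j ] (a * (Q + 1) ≡ (2 * j + 1) * N ⊎ a * (Q ∸ 1) ≡ (2 * j + 1) * N)
orbit-fixed-point {N} {Q} {a} (j , inj₁ a+kN≡Qa) = j , inj₂ (begin
  a * (Q ∸ 1)             ≡⟨ *-distribˡ-∸ a Q 1 ⟩
  a * Q ∸ a * 1           ≡⟨ cong₂ _∸_ (*-comm a Q) (*-identityʳ a) ⟩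
  Q * a ∸ a               ≡⟨ cong (_∸ a) a+kN≡Qa ⟨
  a + (2 * j + 1) * N ∸ a ≡⟨ m+n∸m≡n a _ ⟩
  (2 * j + 1) * N         ∎)
orbit-fixed-point {N} {Q} {a} (j , inj₂ a+Qa≡kN) = j , inj₁ (begin
  a * (Q + 1)     ≡⟨ solve (a ∷ Q ∷ []) ⟩
  a + Q * a       ≡⟨ a+Qa≡kN ⟩
  (2 * j + 1) * N ∎)

quotient-bound : ∀ {a N D E k} .{{_ : NonZero E}} → a < N → D ≤ E → a * D ≡ k * N → k < E
quotient-bound {a} {N} {D} {E} {k} a<N D≤E aD≡kN = *-cancelʳ-< N k E
  (subst (_< E * N) aD≡kN (≤-<-trans (*-monoʳ-≤ a D≤E) aE<EN))
  where
    aE<EN : a * E < E * N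
    aE<EN = subst (a * E <_) (*-comm N E) (*-monoˡ-< E a<N)

fixed-point-representation : ∀ {N P a} → a < N → Orbit N (2 * P) a a →
  ∃[ ξ ] (Odd ξ × 0 < ξ × ξ < 2 * P ×
    (a * (2 * P + 1) ≡ ξ * N ⊎ a * (2 * P ∸ 1) ≡ ξ * N))
fixed-point-representation {N} {P} {a} a<N orbit with orbit-fixed-point orbit
... | j , representation = ξ , (j , refl) , n≢0⇒n>0 (odd⇒≢0 (j , refl)) , ξ<2P , representation
  where
    ξ = 2 * j + 1
    ξ<1+2P : a * (2 * P + 1) ≡ ξ * N ⊎ a * (2 * P ∸ 1) ≡ ξ * N → ξ < suc (2 * P)
    ξ<1+2P (inj₁ eq) = quotient-bound a<N (≤-reflexive (+-comm (2 * P) 1)) eq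
    ξ<1+2P (inj₂ eq) = quotient-bound a<N (≤-trans (m∸n≤m (2 * P) 1) (n≤1+n (2 * P))) eq
    ξ<2P : ξ < 2 * P
    ξ<2P = ≤∧≢⇒< (m<1+n⇒m≤n (ξ<1+2P representation)) (odd≢even j P)

common-factor : ∀ {N D a k} → 0 < a → a < N → a * D ≡ k * N → 1 < gcd N D
common-factor {N} {D} {a} {k} 0<a a<N aD≡kN =
  ≤∧≢⇒< (n≢0⇒n>0 (gcd[m,n]≢0 N D (inj₁ (m<n⇒n≢0 a<N)))) 1≢gcd
  where
    1≢gcd : 1 ≢ gcd N D
    1≢gcd 1≡gcd = <⇒≱ a<N (∣⇒≤ {{>-nonZero 0<a}} N∣a)
      where
        N∣a : N ∣ a
        N∣a = coprime-divisor (gcd≡1⇒coprime (sym 1≡gcd))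
                              (divides k (trans (*-comm D a) aD≡kN))

f₂-rescale : ∀ m e a c → a * suc e ≡ c * suc m → f₂ m a * suc e ≡ f₂ e c * suc m
f₂-rescale m e zero    zero    _  = refl
f₂-rescale m e (suc a) (suc c) eq = begin
  ∣ 2 * suc a - suc m ∣ * suc e         ≡⟨ *-distribʳ-∣-∣ (suc e) (2 * suc a) (suc m) ⟩
  ∣ 2 * suc a * suc e - suc m * suc e ∣ ≡⟨ cong₂ ∣_-_∣ 2aE≡2cM (*-comm (suc m) (suc e)) ⟩
  ∣ 2 * suc c * suc m - suc e * suc m ∣ ≡⟨ *-distribʳ-∣-∣ (suc m) (2 * suc c) (suc e) ⟨
  ∣ 2 * suc c - suc e ∣ * suc m         ∎
  where
    2aE≡2cM : 2 * suc a * suc e ≡ 2 * suc c * suc m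
    2aE≡2cM = trans (*-assoc 2 (suc a) (suc e))
                    (trans (cong (2 *_) eq) (sym (*-assoc 2 (suc c) (suc m))))

iter-f₂-rescale : ∀ m e t a c → a * suc e ≡ c * suc m →
  iter t (f₂ m) a * suc e ≡ iter t (f₂ e) c * suc m
iter-f₂-rescale m e zero    a c eq = eq
iter-f₂-rescale m e (suc t) a c eq =
  f₂-rescale m e (iter t (f₂ m) a) (iter t (f₂ e) c) (iter-f₂-rescale m e t a c eq)

f₂-odd : ∀ e c → Odd (suc e) → Odd c → c < suc e → Odd (f₂ e c) × f₂ e c < suc e
f₂-odd e c odd-D odd-c c<D with f₂-absDiff e c (odd⇒≢0 odd-c) | parity (f₂ e c)
... | inj₁ f+D≡2c | inj₁ even-f =
  ⊥-elim (odd⇒¬even (subst Odd f+D≡2c (even+odd even-f odd-D)) (c , refl))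
... | inj₂ f+2c≡D | inj₁ even-f =
  ⊥-elim (odd⇒¬even odd-D (subst Even f+2c≡D (even+even even-f (c , refl))))
... | inj₁ f+D≡2c | inj₂ odd-f = odd-f , +-cancelʳ-< (suc e) _ _ f+D<D+D
  where
    f+D<D+D : f₂ e c + suc e < suc e + suc e
    f+D<D+D = subst₂ _<_ (sym f+D≡2c) (cong (suc e +_) (+-identityʳ (suc e))) (*-monoʳ-< 2 c<D)
... | inj₂ f+2c≡D | inj₂ odd-f =
  odd-f , subst (f₂ e c <_) f+2c≡D (m<m+n _ (*-monoʳ-< 2 (n≢0⇒n>0 (odd⇒≢0 odd-c))))

iter-f₂-odd : ∀ e t c → Odd (suc e) → Odd c → c < suc e →
  Odd (iter t (f₂ e) c) × iter t (f₂ e) c < suc e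
iter-f₂-odd e zero    c odd-D odd-c c<D = odd-c , c<D
iter-f₂-odd e (suc t) c odd-D odd-c c<D with iter-f₂-odd e t c odd-D odd-c c<D
... | odd-b , b<D = f₂-odd e _ odd-D odd-b b<D

%-shift : ∀ x y u v D .{{_ : NonZero D}} → x + u * D ≡ y + v * D → x % D ≡ y % D
%-shift x y u v D eq = begin
  x % D           ≡⟨ [m+kn]%n≡m%n x u D ⟨
  (x + u * D) % D ≡⟨ cong (_% D) eq ⟩
  (y + v * D) % D ≡⟨ [m+kn]%n≡m%n y v D ⟩
  y % D           ∎

%-shift≡0 : ∀ x u v D .{{_ : NonZero D}} → x + u * D ≡ v * D → x % D ≡ 0
%-shift≡0 x u v D eq = trans (%-shift x 0 u v D eq) (m<n⇒m%n≡m (>-nonZero⁻¹ D))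

orbit-±1 : ∀ {D P ξ b} .{{_ : NonZero D}} → P ≡ D + 1 ⊎ P + 1 ≡ D → Orbit D P ξ b →
  b % D ≡ ξ % D ⊎ (b + ξ) % D ≡ 0
orbit-±1 {D} {P} {ξ} {b} (inj₁ P≡D+1) (j , inj₁ b+kD≡Pξ) =
  inj₁ (%-shift b ξ (2 * j + 1) ξ D (begin
  b + (2 * j + 1) * D ≡⟨ b+kD≡Pξ ⟩
  P * ξ               ≡⟨ cong (_* ξ) P≡D+1 ⟩
  (D + 1) * ξ         ≡⟨ solve (D ∷ ξ ∷ []) ⟩
  ξ + ξ * D           ∎))
orbit-±1 {D} {P} {ξ} {b} (inj₁ P≡D+1) (j , inj₂ b+Pξ≡kD) =
  inj₂ (%-shift≡0 (b + ξ) ξ (2 * j + 1) D (begin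
  b + ξ + ξ * D       ≡⟨ solve (b ∷ ξ ∷ D ∷ []) ⟩
  b + (D + 1) * ξ     ≡⟨ cong (λ x → b + x * ξ) P≡D+1 ⟨
  b + P * ξ           ≡⟨ b+Pξ≡kD ⟩
  (2 * j + 1) * D     ∎))
orbit-±1 {D} {P} {ξ} {b} (inj₂ P+1≡D) (j , inj₁ b+kD≡Pξ) =
  inj₂ (%-shift≡0 (b + ξ) (2 * j + 1) ξ D (begin
  b + ξ + (2 * j + 1) * D ≡⟨ solve (b ∷ ξ ∷ j ∷ D ∷ []) ⟩
  b + (2 * j + 1) * D + ξ ≡⟨ cong (_+ ξ) b+kD≡Pξ ⟩
  P * ξ + ξ               ≡⟨ solve (P ∷ ξ ∷ []) ⟩
  ξ * (P + 1)             ≡⟨ cong (ξ *_) P+1≡D ⟩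
  ξ * D                   ∎))
orbit-±1 {D} {P} {ξ} {b} (inj₂ P+1≡D) (j , inj₂ b+Pξ≡kD) =
  inj₁ (%-shift b ξ ξ (2 * j + 1) D (begin
  b + ξ * D               ≡⟨ cong (λ x → b + ξ * x) P+1≡D ⟨
  b + ξ * (P + 1)         ≡⟨ solve (b ∷ ξ ∷ P ∷ []) ⟩
  b + P * ξ + ξ           ≡⟨ cong (_+ ξ) b+Pξ≡kD ⟩
  (2 * j + 1) * D + ξ     ≡⟨ +-comm _ ξ ⟩
  ξ + (2 * j + 1) * D     ∎))

odd-sum-%≢0 : ∀ {D b ξ} .{{_ : NonZero D}} → Odd D → Odd b → Odd ξ → b < D → ξ < D →
  (b + ξ) % D ≢ 0
odd-sum-%≢0 {D} {b} {ξ} odd-D odd-b odd-ξ b<D ξ<D b+ξ%D≡0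
  with m%n≡0⇒n∣m (b + ξ) D b+ξ%D≡0
... | divides zero          b+ξ≡0   = odd⇒≢0 odd-b (m+n≡0⇒m≡0 b b+ξ≡0)
... | divides 1             b+ξ≡1*D = odd⇒¬even odd-D
  (subst Even (trans b+ξ≡1*D (*-identityˡ D)) (odd+odd odd-b odd-ξ))
... | divides (suc (suc q)) b+ξ≡qD = <⇒≱ (+-mono-< b<D ξ<D)
  (subst (D + D ≤_) (sym b+ξ≡qD) (+-monoʳ-≤ D (m≤m+n D _)))

odd-points-periodic : ∀ e t → 2 ^ suc t ≡ suc e + 1 ⊎ 2 ^ suc t + 1 ≡ suc e → Odd (suc e) →
  ∀ ξ → Odd ξ → ξ < suc e → iter (suc t) (f₂ e) ξ ≡ ξ
odd-points-periodic e t P≡±1 odd-D ξ odd-ξ ξ<D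
  with iter-f₂-odd e (suc t) ξ odd-D odd-ξ ξ<D
... | odd-b , b<D with orbit-±1 P≡±1 (iter-f₂-orbit e t ξ (odd⇒≢0 odd-ξ) (odd⇒≢0 odd-b))
...   | inj₁ b≡ξ   = trans (sym (m<n⇒m%n≡m b<D)) (trans b≡ξ (m<n⇒m%n≡m ξ<D))
...   | inj₂ b+ξ≡0 = ⊥-elim (odd-sum-%≢0 odd-D odd-b odd-ξ b<D ξ<D b+ξ≡0)

common-divisor-fixed-point : ∀ m e t → Odd (suc e) →
  (∀ ξ → Odd ξ → ξ < suc e → iter t (f₂ e) ξ ≡ ξ) →
  1 < gcd (suc m) (suc e) → ∃[ a ] (a ≤ m × a ≢ 0 × iter t (f₂ m) a ≡ a)
common-divisor-fixed-point m e t odd-D periodic 1<g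
  with gcd[m,n]∣m (suc m) (suc e) | gcd[m,n]∣n (suc m) (suc e)
... | divides q N≡qg | divides h D≡hg = q , m<1+n⇒m≤n q<N , q≢0 , q-fixed
  where
    g = gcd (suc m) (suc e)
    q≢0 : q ≢ 0
    q≢0 q≡0 = 1+n≢0 (trans N≡qg (cong (_* g) q≡0))
    q<N : q < suc m
    q<N = subst (q <_) (sym N≡qg) (m<m*n q g {{≢-nonZero q≢0}} 1<g)
    odd-h : Odd h
    odd-h = odd-*ˡ h g (subst Odd D≡hg odd-D)
    h<D : h < suc e
    h<D = subst (h <_) (sym D≡hg) (m<m*n h g {{≢-nonZero (odd⇒≢0 odd-h)}} 1<g)
    qD≡hN : q * suc e ≡ h * suc m
    qD≡hN = begin
      q * suc e   ≡⟨ cong (q *_) D≡hg ⟩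
      q * (h * g) ≡⟨ *-assoc q h g ⟨
      q * h * g   ≡⟨ cong (_* g) (*-comm q h) ⟩
      h * q * g   ≡⟨ *-assoc h q g ⟩
      h * (q * g) ≡⟨ cong (h *_) N≡qg ⟨
      h * suc m   ∎
    q-fixed : iter t (f₂ m) q ≡ q
    q-fixed = *-cancelʳ-≡ _ _ (suc e) (begin
      iter t (f₂ m) q * suc e ≡⟨ iter-f₂-rescale m e t q h qD≡hN ⟩
      iter t (f₂ e) h * suc m ≡⟨ cong (_* suc m) (periodic h odd-h h<D) ⟩
      h * suc m               ≡⟨ qD≡hN ⟨
      q * suc e               ∎)

pow2±1-divisor-fixed-point : ∀ m t D → Odd D → 2 ^ suc t ≡ D + 1 ⊎ 2 ^ suc t + 1 ≡ D →
  1 < gcd (suc m) D → ∃[ a ] (a ≤ m × a ≢ 0 × iter (suc t) (f₂ m) a ≡ a)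
pow2±1-divisor-fixed-point m t zero    odd-D = ⊥-elim (odd⇒≢0 odd-D refl)
pow2±1-divisor-fixed-point m t (suc e) odd-D P≡D±1 =
  common-divisor-fixed-point m e (suc t) odd-D (odd-points-periodic e t P≡D±1 odd-D)

odd-2n∸1 : ∀ n → 0 < n → Odd (2 * n ∸ 1)
odd-2n∸1 (suc n) _ = n , trans (+-suc n (n + 0)) (+-comm 1 (2 * n))

theorem3p3p1 : (m t : ℕ) → 2 ≤ m → 1 ≤ t →
    ((∃[ a ] (a ≤ m × a ≢ 0 × iter t (f₂ m) a ≡ a))
      ⇔ (1 < gcd (m + 1) (2 ^ t + 1) ⊎ 1 < gcd (m + 1) (2 ^ t ∸ 1)))
    × ((a : ℕ) → a ≤ m → a ≢ 0 → iter t (f₂ m) a ≡ a →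
        ∃[ ξ ] (Odd ξ × 0 < ξ × ξ < 2 ^ t ×
          (a * (2 ^ t + 1) ≡ ξ * (m + 1) ⊎ a * (2 ^ t ∸ 1) ≡ ξ * (m + 1))))
theorem3p3p1 m (suc t) _ _ rewrite +-comm m 1 = mk⇔ to from , representation
  where
    representation : (a : ℕ) → a ≤ m → a ≢ 0 → iter (suc t) (f₂ m) a ≡ a →
      ∃[ ξ ] (Odd ξ × 0 < ξ × ξ < 2 ^ suc t ×
        (a * (2 ^ suc t + 1) ≡ ξ * suc m ⊎ a * (2 ^ suc t ∸ 1) ≡ ξ * suc m))
    representation a a≤m a≢0 a-fixed = fixed-point-representation {P = 2 ^ t} (s≤s a≤m)
      (subst (Orbit (suc m) (2 ^ suc t) a) a-fixed
        (iter-f₂-orbit m t a a≢0 (subst (_≢ 0) (sym a-fixed) a≢0)))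

    to : ∃[ a ] (a ≤ m × a ≢ 0 × iter (suc t) (f₂ m) a ≡ a) →
         1 < gcd (suc m) (2 ^ suc t + 1) ⊎ 1 < gcd (suc m) (2 ^ suc t ∸ 1)
    to (a , a≤m , a≢0 , a-fixed) with representation a a≤m a≢0 a-fixed
    ... | ξ , _ , _ , _ , inj₁ eq = inj₁ (common-factor {k = ξ} (n≢0⇒n>0 a≢0) (s≤s a≤m) eq)
    ... | ξ , _ , _ , _ , inj₂ eq = inj₂ (common-factor {k = ξ} (n≢0⇒n>0 a≢0) (s≤s a≤m) eq)

    from : 1 < gcd (suc m) (2 ^ suc t + 1) ⊎ 1 < gcd (suc m) (2 ^ suc t ∸ 1) →
           ∃[ a ] (a ≤ m × a ≢ 0 × iter (suc t) (f₂ m) a ≡ a)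
    from (inj₁ 1<g) = pow2±1-divisor-fixed-point m t _ (2 ^ t , refl) (inj₂ refl) 1<g
    from (inj₂ 1<g) = pow2±1-divisor-fixed-point m t _ (odd-2n∸1 (2 ^ t) (m^n>0 2 t))
      (inj₁ (sym (m∸n+n≡m (m^n>0 2 (suc t))))) 1<g
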